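{- Let $k\ge 1$ and $n\ge 2k+1$ be integers. Let $t=\lfloor \log_2 k\rfloor+1$, let $q=\lfloor n/2^t\rfloor$ and $r=n-2^t q$ (the quotient and remainder of dividing $n$ by $2^t$), let $\lambda=s(k,k+1+2^t,2^t)$ and $\mu=w(k,r+2^t)$. Then $$w(k,n)=(q-1)\lambda+\mu.$$
   Context: Work over the field $\mathbb{F}_2$ of order $2$. For $\mathbf{x}=(x_0,\ldots,x_{n-1})\in\mathbb{F}_2^n$, its derivative is $\partial\mathbf{x}=(x_0+x_1,x_1+x_2,\ldots,x_{n-2}+x_{n-1})\in\mathbb{F}_2^{n-1}$; set $\partial^0\mathbf{x}=\mathbf{x}$ and $\partial^{j}\mathbf{x}=\partial(\partial^{j-1}\mathbf{x})$ for $j\ge1$. The Steinhaus triangle generated by $\mathbf{x}$ is $T(\mathbf{x})=(\mathbf{x},\partial\mathbf{x},\ldots,\partial^{n-1}\mathbf{x})$; its row $j$ (rows numbered $0,\ldots,n-1$) is $\partial^j\mathbf{x}$. The weight $|\mathbf{y}|$ of a binary sequence is its number of entries equal to $1$, and the weight of the triangle is $|T(\mathbf{x})|=\sum_{j=0}^{n-1}|\partial^j\mathbf{x}|$. For $n\ge1$ and $0\le k\le n-1$, let $\mathbf{e}_k^{(n)}\in\mathbb{F}_2^n$ be the sequence with a $1$ in position $k$ (positions numbered $0,\ldots,n-1$) and $0$ elsewhere. Define $T(k,n)=T(\mathbf{e}_k^{(n)})$ and $w(k,n)=|T(k,n)|$. For $1\le m\le n$, let $s(k,n,m)=\sum_{j=0}^{m-1}|\partial^j\mathbf{e}_k^{(n)}|$,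 the sum of the weights of rows $0,1,\ldots,m-1$ of $T(k,n)$. -}

module Defs where

open import Data.Bool using (Bool; true; false; _xor_)
open import Data.Nat using (ℕ; zero; suc; _+_; _∸_)
open import Data.List using (List; []; _∷_; replicate; _++_)

-- Binary sequences over F₂ are lists of Bool (true = 1, xor = addition in F₂).

∂ : List Bool → List Bool
∂ [] = []
∂ (x ∷ []) = []
∂ (x ∷ y ∷ ys) = (x xor y) ∷ ∂ (y ∷ ys)

∂^ : ℕ → List Bool → List Bool
∂^ zero x = x
∂^ (suc j) x = ∂ (∂^ j x)

weight : List Bool → ℕ
weight [] = 0
weight (true ∷ xs) = suc (weight xs)
weight (false ∷ xs) = weight xs

-- e_k^{(n)}: length n, a single 1 in position k (intended for k ≤ n-1)
e : ℕ → ℕ → List Bool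
e k n = replicate k false ++ (true ∷ replicate (n ∸ suc k) false)

rowsWeight : ℕ → List Bool → ℕ
rowsWeight zero x = 0
rowsWeight (suc m) x = rowsWeight m x + weight (∂^ m x)

s : ℕ → ℕ → ℕ → ℕ
s k n m = rowsWeight m (e k n)

-- w(k,n) = |T(k,n)| = Σ_{j=0}^{n-1} |∂^j e_k^{(n)}|
w : ℕ → ℕ → ℕ
w k n = rowsWeight n (e k n)

open import Data.Nat using (_^_)
open import Data.Nat.DivMod using (_/_; _%_)
open import Data.Nat.Properties using (m^n≢0)

div2^ : ℕ → ℕ → ℕ
div2^ n t = _/_ n (2 ^ t) {{m^n≢0 2 t}}

mod2^ : ℕ → ℕ → ℕ
mod2^ n t = _%_ n (2 ^ t) {{m^n≢0 2 t}}

module Submission where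

open import Defs
open import Data.Bool using (Bool; true; false; _xor_)
open import Data.Bool.Properties using (xor-assoc; xor-same; xor-identityʳ)
open import Data.List using (List; []; _∷_; [_]; _++_; replicate; zipWith; drop; take; length)
open import Data.List.Properties using (++-assoc; ++-identityʳ; zipWith-zeroʳ; drop-drop; length-drop)
open import Data.Nat using (ℕ; zero; suc; _+_; _*_; _∸_; _^_; _≤_; _<_; s≤s; z≤n; NonZero; ⌊_/2⌋; ⌈_/2⌉)
open import Data.Nat.Properties
open import Data.Nat.DivMod using (_/_; _%_; m≡m%n+[m/n]*n; m≥n⇒m/n>0)
open import Data.Nat.Induction using (<-rec)
open import Data.Nat.Logarithm using (⌊log₂_⌋; ⌊log₂⌋-mono-≤; ⌊log₂⌊n/2⌋⌋≡⌊log₂n⌋∸1; ⌊log₂[2^n]⌋≡n)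
open import Relation.Binary.PropositionalEquality using (_≡_; refl; sym; trans; cong; cong₂; subst; module ≡-Reasoning)

-- Over F₂ the binomial coefficients C(2^t, i) vanish for 0 < i < 2^t, so
-- ∂^(2^t) x is x_i + x_{i+2^t}.  For e_k with k < 2^t this means that
-- ∂^(2^t) e_k^(N+2^t) = e_k^(N); meanwhile rows 0, …, 2^t - 1 of T(k, N + 2^t)
-- do not see how long the trailing run of zeros is, so they have the weights
-- of T(k, k+1+2^t).  Hence w(k, N + 2^t) = λ + w(k, N) whenever N > k, and the
-- formula follows by peeling 2^t off n exactly q - 1 times; the choice of t
-- makes 2^t ≤ 2k < n, so that q ≥ 1.

zeros : ℕ → List Bool
zeros n = replicate n false

drop-++ : ∀ {A : Set} (xs ys : List A) {n} → length xs ≤ n → drop n (xs ++ ys) ≡ drop (n ∸ length xs) ys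
drop-++ []       ys _         = refl
drop-++ (x ∷ xs) ys (s≤s le) = drop-++ xs ys le

take-++ : ∀ {A : Set} (xs ys : List A) n → take (length xs + n) (xs ++ ys) ≡ xs ++ take n ys
take-++ []       ys n = refl
take-++ (x ∷ xs) ys n = cong (x ∷_) (take-++ xs ys n)

drop-replicate : ∀ {A : Set} m n (x : A) → drop m (replicate n x) ≡ replicate (n ∸ m) x
drop-replicate zero    n       x = refl
drop-replicate (suc m) zero    x = refl
drop-replicate (suc m) (suc n) x = drop-replicate m n x

take-replicate : ∀ {A : Set} m n (x : A) → take m (replicate (m + n) x) ≡ replicate m x
take-replicate zero    n x = refl
take-replicate (suc m) n x = cong (x ∷_) (take-replicate m n x)

drop-zipWith : ∀ {A B C : Set} (f : A → B → C) n xs ys →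
               drop n (zipWith f xs ys) ≡ zipWith f (drop n xs) (drop n ys)
drop-zipWith f zero    xs       ys       = refl
drop-zipWith f (suc n) []       ys       = refl
drop-zipWith f (suc n) (x ∷ xs) []       = sym (zipWith-zeroʳ f (drop n xs))
drop-zipWith f (suc n) (x ∷ xs) (y ∷ ys) = drop-zipWith f n xs ys

zipWith-xor-zeros : ∀ xs n → zipWith _xor_ xs (zeros n) ≡ take n xs
zipWith-xor-zeros []       zero    = refl
zipWith-xor-zeros []       (suc n) = refl
zipWith-xor-zeros (x ∷ xs) zero    = refl
zipWith-xor-zeros (x ∷ xs) (suc n) = cong₂ _∷_ (xor-identityʳ x) (zipWith-xor-zeros xs n)

zipWith-xor-telescope : ∀ xs ys zs → length zs ≤ length ys →
  zipWith _xor_ (zipWith _xor_ xs ys) (zipWith _xor_ ys zs) ≡ zipWith _xor_ xs zs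
zipWith-xor-telescope []       ys       zs       _         = refl
zipWith-xor-telescope (x ∷ xs) []       []       _         = refl
zipWith-xor-telescope (x ∷ xs) (y ∷ ys) []       _         = refl
zipWith-xor-telescope (x ∷ xs) (y ∷ ys) (z ∷ zs) (s≤s le) =
  cong₂ _∷_ xor-cancel (zipWith-xor-telescope xs ys zs le)
  where
  xor-cancel : (x xor y) xor (y xor z) ≡ x xor z
  xor-cancel = trans (xor-assoc x y (y xor z))
                     (cong (x xor_) (trans (sym (xor-assoc y y z)) (cong (_xor z) (xor-same y))))

∂^-+ : ∀ a b x → ∂^ (a + b) x ≡ ∂^ a (∂^ b x)
∂^-+ zero    b x = refl
∂^-+ (suc a) b x = cong ∂ (∂^-+ a b x)

∂^-suc : ∀ j x → ∂^ (suc j) x ≡ ∂^ j (∂ x)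
∂^-suc zero    x = refl
∂^-suc (suc j) x = cong ∂ (∂^-suc j x)

Δ : ℕ → List Bool → List Bool
Δ d x = zipWith _xor_ x (drop d x)

∂≡Δ1 : ∀ x → ∂ x ≡ Δ 1 x
∂≡Δ1 []          = refl
∂≡Δ1 (a ∷ [])     = refl
∂≡Δ1 (a ∷ b ∷ x) = cong ((a xor b) ∷_) (∂≡Δ1 (b ∷ x))

Δ-Δ : ∀ d x → Δ d (Δ d x) ≡ Δ (d + d) x
Δ-Δ d x = begin
  zipWith _xor_ (Δ d x) (drop d (Δ d x))
    ≡⟨ cong (zipWith _xor_ (Δ d x)) (drop-zipWith _xor_ d x (drop d x)) ⟩
  zipWith _xor_ (Δ d x) (zipWith _xor_ (drop d x) (drop d (drop d x)))
    ≡⟨ zipWith-xor-telescope x (drop d x) (drop d (drop d x)) |drop²|≤|drop| ⟩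
  zipWith _xor_ x (drop d (drop d x))
    ≡⟨ cong (zipWith _xor_ x) (drop-drop d d x) ⟩
  Δ (d + d) x ∎
  where
  open ≡-Reasoning
  |drop²|≤|drop| : length (drop d (drop d x)) ≤ length (drop d x)
  |drop²|≤|drop| = subst (_≤ length (drop d x)) (sym (length-drop d (drop d x))) (m∸n≤m _ d)

∂^2^≡Δ2^ : ∀ t x → ∂^ (2 ^ t) x ≡ Δ (2 ^ t) x
∂^2^≡Δ2^ zero    x = ∂≡Δ1 x
∂^2^≡Δ2^ (suc t) x = begin
  ∂^ (P + (P + 0)) x  ≡⟨ cong (λ i → ∂^ (P + i) x) (+-identityʳ P) ⟩
  ∂^ (P + P) x        ≡⟨ ∂^-+ P P x ⟩
  ∂^ P (∂^ P x)       ≡⟨ ∂^2^≡Δ2^ t (∂^ P x) ⟩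
  Δ P (∂^ P x)        ≡⟨ cong (Δ P) (∂^2^≡Δ2^ t x) ⟩
  Δ P (Δ P x)         ≡⟨ Δ-Δ P x ⟩
  Δ (P + P) x         ≡⟨ cong (λ i → Δ (P + i) x) (+-identityʳ P) ⟨
  Δ (P + (P + 0)) x   ∎
  where
  open ≡-Reasoning
  P = 2 ^ t

Δ-++-zeros : ∀ d a y → length y ≤ d → Δ d (y ++ zeros (a + d)) ≡ y ++ zeros a
Δ-++-zeros d a y |y|≤d = begin
  zipWith _xor_ x (drop d x)
    ≡⟨ cong (zipWith _xor_ x) (drop-++ y (zeros (a + d)) |y|≤d) ⟩
  zipWith _xor_ x (drop (d ∸ length y) (zeros (a + d)))
    ≡⟨ cong (zipWith _xor_ x) (drop-replicate (d ∸ length y) (a + d) false) ⟩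
  zipWith _xor_ x (zeros (a + d ∸ (d ∸ length y)))
    ≡⟨ cong (λ i → zipWith _xor_ x (zeros i)) length-of-shift ⟩
  zipWith _xor_ x (zeros (length y + a))
    ≡⟨ zipWith-xor-zeros x (length y + a) ⟩
  take (length y + a) x
    ≡⟨ take-++ y (zeros (a + d)) a ⟩
  y ++ take a (zeros (a + d))
    ≡⟨ cong (y ++_) (take-replicate a d false) ⟩
  y ++ zeros a ∎
  where
  open ≡-Reasoning
  x = y ++ zeros (a + d)
  length-of-shift : a + d ∸ (d ∸ length y) ≡ length y + a
  length-of-shift = begin
    a + d ∸ (d ∸ length y)   ≡⟨ +-∸-assoc a (m∸n≤m d (length y)) ⟩
    a + (d ∸ (d ∸ length y)) ≡⟨ cong (a +_) (m∸[m∸n]≡n |y|≤d) ⟩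
    a + length y             ≡⟨ +-comm a (length y) ⟩
    length y + a             ∎

∂-++ : ∀ xs b ys → ∂ (xs ++ b ∷ ys) ≡ ∂ (xs ++ [ b ]) ++ ∂ (b ∷ ys)
∂-++ []           b ys = refl
∂-++ (x ∷ [])     b ys = refl
∂-++ (x ∷ y ∷ xs) b ys = cong ((x xor y) ∷_) (∂-++ (y ∷ xs) b ys)

∂-zeros : ∀ n → ∂ (zeros (suc n)) ≡ zeros n
∂-zeros zero    = refl
∂-zeros (suc n) = cong (false ∷_) (∂-zeros n)

∂-++-zeros : ∀ y n → ∂ (y ++ zeros (suc n)) ≡ ∂ (y ++ [ false ]) ++ zeros n
∂-++-zeros y n = trans (∂-++ y false (zeros n)) (cong (∂ (y ++ [ false ]) ++_) (∂-zeros n))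

∂^-++-zeros : ∀ j y z → ∂^ j (y ++ zeros (j + z)) ≡ ∂^ j (y ++ zeros j) ++ zeros z
∂^-++-zeros zero    y z = cong (_++ zeros z) (sym (++-identityʳ y))
∂^-++-zeros (suc j) y z = begin
  ∂^ (suc j) (y ++ zeros (suc j + z))      ≡⟨ ∂^-suc j _ ⟩
  ∂^ j (∂ (y ++ zeros (suc (j + z))))      ≡⟨ cong (∂^ j) (∂-++-zeros y (j + z)) ⟩
  ∂^ j (y′ ++ zeros (j + z))               ≡⟨ ∂^-++-zeros j y′ z ⟩
  ∂^ j (y′ ++ zeros j) ++ zeros z          ≡⟨ cong (λ u → ∂^ j u ++ zeros z) (∂-++-zeros y j) ⟨
  ∂^ j (∂ (y ++ zeros (suc j))) ++ zeros z ≡⟨ cong (_++ zeros z) (∂^-suc j _) ⟨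
  ∂^ (suc j) (y ++ zeros (suc j)) ++ zeros z ∎
  where
  open ≡-Reasoning
  y′ = ∂ (y ++ [ false ])

weight-++ : ∀ xs ys → weight (xs ++ ys) ≡ weight xs + weight ys
weight-++ []           ys = refl
weight-++ (true ∷ xs)  ys = cong suc (weight-++ xs ys)
weight-++ (false ∷ xs) ys = weight-++ xs ys

weight-zeros : ∀ n → weight (zeros n) ≡ 0
weight-zeros zero    = refl
weight-zeros (suc n) = weight-zeros n

weight-++-zeros : ∀ xs n → weight (xs ++ zeros n) ≡ weight xs
weight-++-zeros xs n = trans (weight-++ xs (zeros n)) (trans (cong (weight xs +_) (weight-zeros n)) (+-identityʳ _))

weight-∂^-++-zeros : ∀ {i m} y → i ≤ m → weight (∂^ i (y ++ zeros m)) ≡ weight (∂^ i (y ++ zeros i))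
weight-∂^-++-zeros {i} {m} y i≤m = begin
  weight (∂^ i (y ++ zeros m))                   ≡⟨ cong (λ n → weight (∂^ i (y ++ zeros n))) (m+[n∸m]≡n i≤m) ⟨
  weight (∂^ i (y ++ zeros (i + (m ∸ i))))       ≡⟨ cong weight (∂^-++-zeros i y (m ∸ i)) ⟩
  weight (∂^ i (y ++ zeros i) ++ zeros (m ∸ i))  ≡⟨ weight-++-zeros (∂^ i (y ++ zeros i)) (m ∸ i) ⟩
  weight (∂^ i (y ++ zeros i))                   ∎
  where open ≡-Reasoning

rowsWeight-++-zeros : ∀ j m c y → j ≤ m → rowsWeight j (y ++ zeros (c + m)) ≡ rowsWeight j (y ++ zeros m)
rowsWeight-++-zeros zero    m c y _   = refl
rowsWeight-++-zeros (suc j) m c y j<m = cong₂ _+_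
  (rowsWeight-++-zeros j m c y (<⇒≤ j<m))
  (trans (weight-∂^-++-zeros y (≤-trans (<⇒≤ j<m) (m≤n+m m c))) (sym (weight-∂^-++-zeros y (<⇒≤ j<m))))

rowsWeight-+ : ∀ a b x → rowsWeight (a + b) x ≡ rowsWeight b x + rowsWeight a (∂^ b x)
rowsWeight-+ zero    b x = sym (+-identityʳ _)
rowsWeight-+ (suc a) b x = trans (cong₂ _+_ (rowsWeight-+ a b x) (cong weight (∂^-+ a b x)))
                                 (+-assoc (rowsWeight b x) _ _)

rowsWeight-++-zeros-+2^ : ∀ t m a y → length y ≤ 2 ^ t →
  rowsWeight (m + 2 ^ t) (y ++ zeros (a + 2 ^ t)) ≡ rowsWeight (2 ^ t) (y ++ zeros (2 ^ t)) + rowsWeight m (y ++ zeros a)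
rowsWeight-++-zeros-+2^ t m a y |y|≤P = begin
  rowsWeight (m + P) x                         ≡⟨ rowsWeight-+ m P x ⟩
  rowsWeight P x + rowsWeight m (∂^ P x)       ≡⟨ cong₂ _+_ (rowsWeight-++-zeros P P a y ≤-refl)
                                                           (cong (rowsWeight m) (trans (∂^2^≡Δ2^ t x) (Δ-++-zeros P a y |y|≤P))) ⟩
  rowsWeight P (y ++ zeros P) + rowsWeight m (y ++ zeros a) ∎
  where
  open ≡-Reasoning
  P = 2 ^ t
  x = y ++ zeros (a + P)

e-++-zeros : ∀ k m → e k (suc k + m) ≡ (zeros k ++ [ true ]) ++ zeros m
e-++-zeros k m = begin
  zeros k ++ true ∷ zeros (k + m ∸ k)  ≡⟨ cong (λ i → zeros k ++ true ∷ zeros i) (m+n∸m≡n k m) ⟩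
  zeros k ++ true ∷ zeros m            ≡⟨ ++-assoc (zeros k) [ true ] (zeros m) ⟨
  (zeros k ++ [ true ]) ++ zeros m     ∎
  where open ≡-Reasoning

length-zeros++[true] : ∀ k → length (zeros k ++ [ true ]) ≡ suc k
length-zeros++[true] zero    = refl
length-zeros++[true] (suc k) = cong suc (length-zeros++[true] k)

w-suc+-+2^ : ∀ t k a → k < 2 ^ t →
  w k (suc k + a + 2 ^ t) ≡ s k (k + 1 + 2 ^ t) (2 ^ t) + w k (suc k + a)
w-suc+-+2^ t k a k<P = begin
  rowsWeight (N + P) (e k (N + P))                          ≡⟨ cong (λ i → rowsWeight (N + P) (e k i)) (+-assoc (suc k) a P) ⟩
  rowsWeight (N + P) (e k (suc k + (a + P)))                ≡⟨ cong (rowsWeight (N + P)) (e-++-zeros k (a + P)) ⟩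
  rowsWeight (N + P) (y ++ zeros (a + P))                   ≡⟨ rowsWeight-++-zeros-+2^ t N a y |y|≤P ⟩
  rowsWeight P (y ++ zeros P) + rowsWeight N (y ++ zeros a) ≡⟨ cong₂ _+_ (cong (rowsWeight P) (e-++-zeros k P))
                                                                        (cong (rowsWeight N) (e-++-zeros k a)) ⟨
  s k (1 + k + P) P + w k N                                 ≡⟨ cong (λ i → s k (i + P) P + w k N) (+-comm 1 k) ⟩
  s k (k + 1 + P) P + w k N                                 ∎
  where
  open ≡-Reasoning
  P = 2 ^ t
  N = suc k + a
  y = zeros k ++ [ true ]
  |y|≤P : length y ≤ P
  |y|≤P = subst (_≤ P) (sym (length-zeros++[true] k)) k<P

w-+2^ : ∀ t k N → k < 2 ^ t → k < N → w k (N + 2 ^ t) ≡ s k (k + 1 + 2 ^ t) (2 ^ t) + w k N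
w-+2^ t k N k<P k<N =
  subst (λ M → w k (M + 2 ^ t) ≡ s k (k + 1 + 2 ^ t) (2 ^ t) + w k M) (m+[n∸m]≡n k<N) (w-suc+-+2^ t k (N ∸ suc k) k<P)

w-+*2^ : ∀ t k N q → k < 2 ^ t → k < N → w k (N + q * 2 ^ t) ≡ q * s k (k + 1 + 2 ^ t) (2 ^ t) + w k N
w-+*2^ t k N zero    k<P k<N = cong (w k) (+-identityʳ N)
w-+*2^ t k N (suc q) k<P k<N = begin
  w k (N + (P + q * P))   ≡⟨ cong (w k) (trans (cong (N +_) (+-comm P (q * P))) (sym (+-assoc N (q * P) P))) ⟩
  w k (N + q * P + P)     ≡⟨ w-+2^ t k (N + q * P) k<P (≤-trans k<N (m≤m+n N (q * P))) ⟩
  ℓ + w k (N + q * P)     ≡⟨ cong (ℓ +_) (w-+*2^ t k N q k<P k<N) ⟩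
  ℓ + (q * ℓ + w k N)     ≡⟨ +-assoc ℓ (q * ℓ) (w k N) ⟨
  ℓ + q * ℓ + w k N       ∎
  where
  open ≡-Reasoning
  P = 2 ^ t
  ℓ = s k (k + 1 + P) P

2*⌊n/2⌋≤n : ∀ n → 2 * ⌊ n /2⌋ ≤ n
2*⌊n/2⌋≤n n = begin
  2 * h       ≡⟨ cong (h +_) (+-identityʳ h) ⟩
  h + h       ≤⟨ +-monoʳ-≤ h (⌊n/2⌋≤⌈n/2⌉ n) ⟩
  h + ⌈ n /2⌉ ≡⟨ ⌊n/2⌋+⌈n/2⌉≡n n ⟩
  n           ∎
  where
  open ≤-Reasoning
  h = ⌊ n /2⌋

2^⌊log₂n⌋≤n : ∀ n → 1 ≤ n → 2 ^ ⌊log₂ n ⌋ ≤ n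
2^⌊log₂n⌋≤n = <-rec (λ n → 1 ≤ n → 2 ^ ⌊log₂ n ⌋ ≤ n) bound
  where
  bound : ∀ n → (∀ {m} → m < n → 1 ≤ m → 2 ^ ⌊log₂ m ⌋ ≤ m) → 1 ≤ n → 2 ^ ⌊log₂ n ⌋ ≤ n
  bound 1               _   _ = ≤-refl
  bound n@(suc (suc m)) rec _ = begin
    2 ^ L                 ≡⟨ cong (2 ^_) (m+[n∸m]≡n 1≤L) ⟨
    2 * 2 ^ (L ∸ 1)       ≡⟨ cong (λ i → 2 * 2 ^ i) (⌊log₂⌊n/2⌋⌋≡⌊log₂n⌋∸1 n) ⟨
    2 * 2 ^ ⌊log₂ h ⌋     ≤⟨ *-monoʳ-≤ 2 (rec (⌊n/2⌋<n (suc m)) (s≤s z≤n)) ⟩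
    2 * h                 ≤⟨ 2*⌊n/2⌋≤n n ⟩
    n                     ∎
    where
    open ≤-Reasoning
    h = ⌊ n /2⌋
    L = ⌊log₂ n ⌋
    1≤L : 1 ≤ L
    1≤L = ⌊log₂⌋-mono-≤ {2} {n} (s≤s (s≤s z≤n))

n<2^[⌊log₂n⌋+1] : ∀ n → n < 2 ^ (⌊log₂ n ⌋ + 1)
n<2^[⌊log₂n⌋+1] n = ≰⇒> λ 2^[L+1]≤n →
  1+n≰n (subst (_≤ ⌊log₂ n ⌋) (trans (⌊log₂[2^n]⌋≡n (⌊log₂ n ⌋ + 1)) (+-comm _ 1)) (⌊log₂⌋-mono-≤ 2^[L+1]≤n))

2^[⌊log₂n⌋+1]≤2n : ∀ n → 1 ≤ n → 2 ^ (⌊log₂ n ⌋ + 1) ≤ 2 * n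
2^[⌊log₂n⌋+1]≤2n n 1≤n = subst (_≤ 2 * n) (cong (2 ^_) (+-comm 1 ⌊log₂ n ⌋)) (*-monoʳ-≤ 2 (2^⌊log₂n⌋≤n n 1≤n))

m≡m%n+n+[m/n∸1]*n : ∀ m n .{{_ : NonZero n}} → n ≤ m → m ≡ m % n + n + (m / n ∸ 1) * n
m≡m%n+n+[m/n∸1]*n m n n≤m = begin
  m                                ≡⟨ m≡m%n+[m/n]*n m n ⟩
  m % n + m / n * n                ≡⟨ cong (λ q → m % n + q * n) (m+[n∸m]≡n (m≥n⇒m/n>0 n≤m)) ⟨
  m % n + (n + (m / n ∸ 1) * n)    ≡⟨ +-assoc (m % n) n _ ⟨
  m % n + n + (m / n ∸ 1) * n      ∎
  where open ≡-Reasoning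

theorem2 : (k n : ℕ) → 1 ≤ k → 2 * k + 1 ≤ n →
    w k n ≡ (div2^ n (⌊log₂ k ⌋ + 1) ∸ 1) * s k (k + 1 + 2 ^ (⌊log₂ k ⌋ + 1)) (2 ^ (⌊log₂ k ⌋ + 1))
    + w k (mod2^ n (⌊log₂ k ⌋ + 1) + 2 ^ (⌊log₂ k ⌋ + 1))
theorem2 k n 1≤k 2k+1≤n = begin
  w k n                   ≡⟨ cong (w k) (m≡m%n+n+[m/n∸1]*n n P {{m^n≢0 2 t}} P≤n) ⟩
  w k (r + P + q′ * P)    ≡⟨ w-+*2^ t k (r + P) q′ k<P (≤-trans k<P (m≤n+m P r)) ⟩
  q′ * s k (k + 1 + P) P + w k (r + P) ∎
  where
  open ≡-Reasoning
  t = ⌊log₂ k ⌋ + 1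
  P = 2 ^ t
  r = mod2^ n t
  q′ = div2^ n t ∸ 1
  k<P : k < P
  k<P = n<2^[⌊log₂n⌋+1] k
  P≤n : P ≤ n
  P≤n = ≤-trans (2^[⌊log₂n⌋+1]≤2n k 1≤k) (≤-trans (m≤m+n (2 * k) 1) 2k+1≤n)
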